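{- Let $p$ and $q$ be primes with $p<q$ and let $G$ be a cyclic group of order $p^2q^2$. Then \begin{align*} \mathcal{B}(G)\cong{}& K_2 \sqcup K_{1, p^2-1} \sqcup K_{1, p^4-p^2} \sqcup K_{1, q^2-1} \sqcup K_{1, q^4-q^2} \sqcup K_{1, p^2q^2-p^2-q^2+1}\\ &\sqcup K_{1, p^2q^4-p^2q^2-q^4+q^2} \sqcup K_{1, p^4q^2-p^2q^2-p^4+p^2} \sqcup K_{1, p^4q^4-p^2q^4-p^4q^2+p^2q^2}. \end{align*}
   Context: For a finite group $G$, let $L(G)$ be the set of all subgroups of $G$. The subgroup generating bipartite graph (SGB-graph) $\mathcal{B}(G)$ is the bipartite graph with vertex set $(G\times G)\sqcup L(G)$, in which a vertex $(a,b)\in G\times G$ is adjacent to $H\in L(G)$ if and only if $H=\langle a,b\rangle$; there are no other edges. $K_{1,r}$ denotes the star with $r$ leaves, $K_2$ the complete graph on two vertices, and $\sqcup$ the disjoint union of graphs. -}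

module Defs where

open import Data.Nat using (ℕ; zero; suc; _∸_; _+_)
open import Data.Nat.DivMod using (_%_; m%n<n)
open import Data.Fin using (Fin; zero; suc; toℕ; fromℕ<)
open import Data.Fin.Subset using (Subset; _∈_; _⊆_)
open import Data.Fin.Subset.Properties using (_∈?_)
open import Data.Fin.Properties using (all?)
open import Data.Product using (Σ; _×_; _,_)
open import Data.Sum using (_⊎_; inj₁; inj₂)
open import Data.Unit using (⊤; tt)
open import Data.Empty using (⊥)
open import Relation.Nullary using (¬_; Dec; yes; no)
open import Relation.Nullary.Decidable using (True; _×-dec_; _→-dec_)
open import Relation.Binary.PropositionalEquality using (_≡_)
open import Function.Bundles using (_↔_; _⇔_; Inverse)

_⊕_ : ∀ {n} → Fin n → Fin n → Fin n
_⊕_ {suc m} i j = fromℕ< (m%n<n (toℕ i + toℕ j) (suc m))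

⊖_ : ∀ {n} → Fin n → Fin n
⊖_ {suc m} i = fromℕ< (m%n<n (suc m ∸ toℕ i) (suc m))

HasZero : ∀ {n} → Subset n → Set
HasZero {zero}  S = ⊥
HasZero {suc m} S = zero ∈ S

hasZero? : ∀ {n} (S : Subset n) → Dec (HasZero S)
hasZero? {zero}  S = no (λ ())
hasZero? {suc m} S = zero ∈? S

IsSubgroup : ∀ {n} → Subset n → Set
IsSubgroup {n} S =
  HasZero S
  × (∀ i j → i ∈ S → j ∈ S → (i ⊕ j) ∈ S)
  × (∀ i → i ∈ S → (⊖ i) ∈ S)

isSubgroup? : ∀ {n} (S : Subset n) → Dec (IsSubgroup S)
isSubgroup? S =
  hasZero? S
  ×-dec all? (λ i → all? (λ j → (i ∈? S) →-dec ((j ∈? S) →-dec ((i ⊕ j) ∈? S))))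
  ×-dec all? (λ i → (i ∈? S) →-dec ((⊖ i) ∈? S))

-- L(G): the set of subgroups (a subset together with a proof-irrelevant
-- certificate that it is a subgroup, so distinct vertices = distinct subsets).
L : ℕ → Set
L n = Σ (Subset n) (λ S → True (isSubgroup? S))

IsGeneratedBy : ∀ {n} → Subset n → Fin n → Fin n → Set
IsGeneratedBy {n} H a b =
  a ∈ H × b ∈ H × (∀ (K : Subset n) → IsSubgroup K → a ∈ K → b ∈ K → H ⊆ K)

record Graph : Set₁ where
  field
    V : Set
    E : V → V → Set
open Graph public

record _≅_ (G H : Graph) : Set where
  field
    f   : V G ↔ V H
    adj : ∀ x y → E G x y ⇔ E H (Inverse.to f x) (Inverse.to f y)

SGB : ℕ → Graph
SGB n = record { V = (Fin n × Fin n) ⊎ L n ; E = adjB }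
  where
  adjB : (Fin n × Fin n) ⊎ L n → (Fin n × Fin n) ⊎ L n → Set
  adjB (inj₁ (a , b)) (inj₂ (H , _)) = IsGeneratedBy H a b
  adjB (inj₂ (H , _)) (inj₁ (a , b)) = IsGeneratedBy H a b
  adjB _ _ = ⊥

_⊔_ : Graph → Graph → Graph
G ⊔ H = record { V = V G ⊎ V H ; E = e }
  where
  e : V G ⊎ V H → V G ⊎ V H → Set
  e (inj₁ x) (inj₁ y) = E G x y
  e (inj₂ x) (inj₂ y) = E H x y
  e _ _ = ⊥
infixr 5 _⊔_

K₂ : Graph
K₂ = record { V = Fin 2 ; E = λ x y → ¬ (x ≡ y) }

K₁, : ℕ → Graph
K₁, r = record { V = ⊤ ⊎ Fin r ; E = e }
  where
  e : ⊤ ⊎ Fin r → ⊤ ⊎ Fin r → Set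
  e (inj₁ _) (inj₂ _) = ⊤
  e (inj₂ _) (inj₁ _) = ⊤
  e _ _ = ⊥

module Submission where

-- Each pair (a, b) of ℤ/nℤ generates exactly one subgroup, so the SGB-graph is the graph of the map
-- (a, b) ↦ ⟨a, b⟩: a disjoint union of stars, one per subgroup, whose leaves are the pairs generating
-- it. The subgroups of ℤ/nℤ are the sets of multiples of the divisors d of n, and ⟨a, b⟩ is the set
-- of multiples of gcd(n, a, b). For n = p²q² the divisors are p^i q^j with i, j ≤ 2, and the pairs
-- with p^i q^j ∣ gcd(n, a, b) are the pairs of multiples of p^i q^j, of which there are
-- P(i) Q(j) = (p^(2-i))² (q^(2-j))² (and none once i or j exceeds 2). Inclusion–exclusion over
-- p^i q^j, p^(i+1) q^j, p^i q^(j+1) and p^(i+1) q^(j+1) then counts the pairs with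
-- gcd(n, a, b) = p^i q^j as (P(i) - P(i+1)) (Q(j) - Q(j+1)).

open import Defs
open import Level using (0ℓ)
open import Data.Nat using (ℕ; zero; suc; _+_; _*_; _∸_; _^_; _≤_; _<_; z≤n; s≤s; NonZero; _≟_; _≤?_;
  nonTrivial⇒n>1; nonTrivial⇒≢1)
open import Data.Nat.Properties using (+-*-semiring; +-assoc; +-identityʳ; +-cancelʳ-≡; *-assoc; *-comm;
  *-identityˡ; *-identityʳ; *-zeroʳ; *-cancelʳ-≡; *-cancelʳ-<; *-monoˡ-<; *-monoʳ-≤; ^-distribˡ-+-*;
  ^-monoʳ-≤; m^n≢0; m^n>0; m*n≢0; m≤m+n; m≤m*n; m+n∸m≡n; m∸n+n≡m; m+[n∸m]≡n; ∸-+-assoc;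
  m≤n⇒∃[o]m+o≡n; m≤n⇒m≤1+n; ≤-refl; ≤-trans; ≤-antisym; <⇒≤; <⇒≱; ≰⇒>; <-irrefl; <-cmp; <⇒≢;
  ≡-irrelevant)
open import Data.Nat.DivMod using (_%_; _mod_; m%n<n; %-distribˡ-+; [m+kn]%n≡m%n; m<n⇒m%n≡m; n%n≡0)
open import Data.Nat.Divisibility using (_∣_; divides; _∣?_; ∣-trans; ∣-antisym; ∣-refl; ∣-reflexive;
  _∣0; ∣1⇒≡1; m∣m*n; ∣m⇒∣m*n; *-pres-∣; *-cancelˡ-∣; ∣m+n∣m⇒∣n; ∣m∣n⇒∣m+n; %-presˡ-∣; ∣n∣m%n⇒∣m)
open import Data.Nat.GCD using (gcd; gcd[m,n]∣m; gcd[m,n]∣n; gcd-greatest; gcd-GCD; module Bézout)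
open import Data.Nat.Primality using (Prime; prime⇒irreducible; prime⇒nonZero; prime⇒nonTrivial; euclidsLemma)
open import Data.Nat.Coprimality using (Coprime; coprime-divisor)
import Data.Nat.Coprimality as Coprime
open import Data.Nat.Solver using (module +-*-Solver)
open import Data.Fin using (Fin; zero; suc; toℕ; fromℕ<)
open import Data.Fin.Patterns using (0F; 1F; 2F; 3F; 4F; 5F; 6F; 7F; 8F)
open import Data.Fin.Properties using (+↔⊎; suc-injective; toℕ-fromℕ<; fromℕ<-toℕ; toℕ-injective; toℕ<n)
import Data.Fin.Properties as Fin
open import Data.Fin.Permutation using (↔⇒≡)
open import Data.Fin.Subset using (Subset; _∈_; _⊆_)
open import Data.Fin.Subset.Properties using (_∈?_; ⊆-antisym)
open import Data.Vec using (tabulate)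
open import Data.Vec.Properties using (lookup∘tabulate; []=⇒lookup; lookup⇒[]=)
open import Data.Bool using (Bool)
open import Data.Bool.Properties using (T-irrelevant; T-≡)
open import Data.Product using (Σ; ∃; ∃₂; _×_; _,_; proj₁; proj₂)
open import Data.Product.Properties using (≡-dec; ×-≡,≡→≡)
open import Data.Sum using (_⊎_; inj₁; inj₂; [_,_]′)
open import Data.Sum.Function.Propositional using (_⊎-↔_)
open import Data.Unit using (⊤; tt)
open import Data.Empty using (⊥)
open import Relation.Nullary using (¬_; Dec; yes; no; Irrelevant; contradiction)
open import Relation.Nullary.Decidable using (True; ⌊_⌋; toWitness; fromWitness; from-yes; _×-dec_; _→-dec_)
open import Relation.Unary using (Pred; Decidable)
open import Relation.Binary.Definitions using (tri<; tri≈; tri>)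
open import Relation.Binary.PropositionalEquality using (_≡_; _≢_; refl; cong; cong₂; sym; trans; subst; subst₂;
  module ≡-Reasoning)
open import Axiom.UniquenessOfIdentityProofs using (module Decidable⇒UIP)
open import Function.Base using (_∘_)
open import Function.Bundles using (_↔_; _⇔_; Inverse; Equivalence; mk↔ₛ′; mk⇔)
open import Function.Properties.Inverse using (↔-refl; ↔-sym; ↔-trans)
import Function.Properties.Equivalence as ⇔
open import Function.Related.TypeIsomorphisms using (Σ-assoc)
open import Algebra.Properties.Semiring.Sum +-*-semiring using (sum; sum-syntax; sum-cong-≗; sum-replicate-zero;
  ∑-distrib-+; *-distribˡ-sum; *-distribʳ-sum)

open Inverse using (to; from; strictlyInverseˡ; strictlyInverseʳ)
open +-*-Solver using (solve; _:+_; _:*_; _:^_; _:=_; con)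

-- Graphs

≅-refl : ∀ {G} → G ≅ G
≅-refl = record { f = ↔-refl ; adj = λ _ _ → ⇔.refl }

≅-trans : ∀ {G H K} → G ≅ H → H ≅ K → G ≅ K
≅-trans i j = record
  { f   = ↔-trans (_≅_.f i) (_≅_.f j)
  ; adj = λ x y → ⇔.trans (_≅_.adj i x y) (_≅_.adj j _ _)
  }

⊔-cong : ∀ {G G′ H H′} → G ≅ G′ → H ≅ H′ → (G ⊔ H) ≅ (G′ ⊔ H′)
⊔-cong i j = record
  { f   = _≅_.f i ⊎-↔ _≅_.f j
  ; adj = λ { (inj₁ x) (inj₁ y) → _≅_.adj i x y
            ; (inj₁ x) (inj₂ y) → ⇔.refl
            ; (inj₂ x) (inj₁ y) → ⇔.refl
            ; (inj₂ x) (inj₂ y) → _≅_.adj j x y }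
  }

FunctionGraph : {X Y : Set} → (X → Y) → Graph
FunctionGraph {X} {Y} c = record { V = X ⊎ Y ; E = edge }
  where
  edge : X ⊎ Y → X ⊎ Y → Set
  edge (inj₁ x) (inj₂ y) = c x ≡ y
  edge (inj₂ y) (inj₁ x) = c x ≡ y
  edge _        _        = ⊥

CentreLeaf : {A B : Set} → ⊤ ⊎ A → ⊤ ⊎ B → Set
CentreLeaf (inj₁ _) (inj₂ _) = ⊤
CentreLeaf (inj₂ _) (inj₁ _) = ⊤
CentreLeaf _        _        = ⊥

StarForest : (I : Set) → (I → ℕ) → Graph
StarForest I r = record
  { V = Σ I (λ i → ⊤ ⊎ Fin (r i))
  ; E = λ { (i , u) (j , v) → i ≡ j × CentreLeaf u v }
  }

Stars : (m : ℕ) → (Fin (suc m) → ℕ) → Graph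
Stars zero    r = K₁, (r 0F)
Stars (suc m) r = K₁, (r 0F) ⊔ Stars m (r ∘ suc)

starForest-split : ∀ m (r : Fin (suc m) → ℕ) →
  StarForest (Fin (suc m)) r ≅ (K₁, (r 0F) ⊔ StarForest (Fin m) (r ∘ suc))
starForest-split m r = record
  { f   = mk↔ₛ′ split join (λ { (inj₁ _) → refl ; (inj₂ _) → refl })
                           (λ { (zero , _) → refl ; (suc _ , _) → refl })
  ; adj = λ { (zero , inj₁ _) (zero , inj₁ _) → mk⇔ proj₂ λ ()
            ; (zero , inj₁ _) (zero , inj₂ _) → mk⇔ proj₂ (refl ,_)
            ; (zero , inj₂ _) (zero , inj₁ _) → mk⇔ proj₂ (refl ,_)
            ; (zero , inj₂ _) (zero , inj₂ _) → mk⇔ proj₂ λ ()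
            ; (zero , _) (suc _ , _) → mk⇔ (λ ()) λ ()
            ; (suc _ , _) (zero , _) → mk⇔ (λ ()) λ ()
            ; (suc i , _) (suc j , _) → mk⇔ (λ (e , l) → suc-injective e , l) (λ (e , l) → cong suc e , l) }
  }
  where
  split : Σ (Fin (suc m)) (λ i → ⊤ ⊎ Fin (r i)) → (⊤ ⊎ Fin (r 0F)) ⊎ Σ (Fin m) (λ i → ⊤ ⊎ Fin (r (suc i)))
  split (zero  , v) = inj₁ v
  split (suc i , v) = inj₂ (i , v)
  join : (⊤ ⊎ Fin (r 0F)) ⊎ Σ (Fin m) (λ i → ⊤ ⊎ Fin (r (suc i))) → Σ (Fin (suc m)) (λ i → ⊤ ⊎ Fin (r i))
  join (inj₁ v)       = zero , v
  join (inj₂ (i , v)) = suc i , v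

starForest-single : ∀ (r : Fin 1 → ℕ) → StarForest (Fin 1) r ≅ K₁, (r 0F)
starForest-single r = record
  { f   = mk↔ₛ′ (λ { (0F , v) → v ; (suc () , _) }) (0F ,_) (λ _ → refl)
                (λ { (0F , _) → refl ; (suc () , _) })
  ; adj = λ { (0F , inj₁ _) (0F , inj₁ _) → mk⇔ proj₂ λ ()
            ; (0F , inj₁ _) (0F , inj₂ _) → mk⇔ proj₂ (refl ,_)
            ; (0F , inj₂ _) (0F , inj₁ _) → mk⇔ proj₂ (refl ,_)
            ; (0F , inj₂ _) (0F , inj₂ _) → mk⇔ proj₂ λ () }
  }

starForest≅stars : ∀ m (r : Fin (suc m) → ℕ) → StarForest (Fin (suc m)) r ≅ Stars m r
starForest≅stars zero    r = starForest-single r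
starForest≅stars (suc m) r = ≅-trans (starForest-split (suc m) r) (⊔-cong ≅-refl (starForest≅stars m (r ∘ suc)))

K₁,₁≅K₂ : K₁, 1 ≅ K₂
K₁,₁≅K₂ = record
  { f   = mk↔ₛ′ (λ { (inj₁ _) → 0F ; (inj₂ 0F) → 1F }) (λ { 0F → inj₁ tt ; 1F → inj₂ 0F })
                (λ { 0F → refl ; 1F → refl }) (λ { (inj₁ _) → refl ; (inj₂ 0F) → refl })
  ; adj = λ { (inj₁ _)  (inj₁ _)  → mk⇔ (λ ()) (λ 0≢0 → 0≢0 refl)
            ; (inj₁ _)  (inj₂ 0F) → mk⇔ (λ _ ()) _
            ; (inj₂ 0F) (inj₁ _)  → mk⇔ (λ _ ()) _
            ; (inj₂ 0F) (inj₂ 0F) → mk⇔ (λ ()) (λ 1≢1 → 1≢1 refl) }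
  }

functionGraph≅starForest : ∀ {X Y : Set} (c : X → Y) (r : Y → ℕ) →
  (∀ y → Σ X (λ x → c x ≡ y) ↔ Fin (r y)) → FunctionGraph c ≅ StarForest Y r
functionGraph≅starForest {X} {Y} c r fibre = record
  { f   = mk↔ₛ′ toForest fromForest toForest∘fromForest
                (λ { (inj₁ x) → cong (inj₁ ∘ proj₁) (strictlyInverseʳ (fibre (c x)) (x , refl))
                   ; (inj₂ y) → refl })
  ; adj = λ { (inj₁ _) (inj₁ _) → mk⇔ (λ ()) proj₂
            ; (inj₁ _) (inj₂ _) → mk⇔ (_, _) proj₁
            ; (inj₂ _) (inj₁ _) → mk⇔ (λ e → sym e , _) (sym ∘ proj₁)
            ; (inj₂ _) (inj₂ _) → mk⇔ (λ ()) proj₂ }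
  }
  where
  leaf : ∀ {x y} → c x ≡ y → Σ Y (λ y → ⊤ ⊎ Fin (r y))
  leaf {x} {y} e = y , inj₂ (to (fibre y) (x , e))
  toForest : X ⊎ Y → Σ Y (λ y → ⊤ ⊎ Fin (r y))
  toForest (inj₁ x) = leaf {x} refl
  toForest (inj₂ y) = y , inj₁ tt
  fromForest : Σ Y (λ y → ⊤ ⊎ Fin (r y)) → X ⊎ Y
  fromForest (y , inj₁ _) = inj₂ y
  fromForest (y , inj₂ l) = inj₁ (proj₁ (from (fibre y) l))
  leaf-refl : ∀ {x y} (e : c x ≡ y) → leaf {x} refl ≡ leaf e
  leaf-refl refl = refl
  toForest∘fromForest : ∀ v → toForest (fromForest v) ≡ v
  toForest∘fromForest (y , inj₁ _) = refl
  toForest∘fromForest (y , inj₂ l) =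
    trans (leaf-refl (proj₂ (from (fibre y) l))) (cong (λ l → y , inj₂ l) (strictlyInverseˡ (fibre y) l))

-- Counting

𝟙 : {P : Set} → Dec P → ℕ
𝟙 (yes _) = 1
𝟙 (no  _) = 0

𝟙-yes : {P : Set} (P? : Dec P) → P → 𝟙 P? ≡ 1
𝟙-yes (yes _) _ = refl
𝟙-yes (no ¬p) p = contradiction p ¬p

𝟙-no : {P : Set} (P? : Dec P) → ¬ P → 𝟙 P? ≡ 0
𝟙-no (yes p) ¬p = contradiction p ¬p
𝟙-no (no _)  _  = refl

𝟙-cong : {P Q : Set} (P? : Dec P) (Q? : Dec Q) → P ⇔ Q → 𝟙 P? ≡ 𝟙 Q?
𝟙-cong P? (yes q) P⇔Q = 𝟙-yes P? (Equivalence.from P⇔Q q)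
𝟙-cong P? (no ¬q) P⇔Q = 𝟙-no P? (¬q ∘ Equivalence.to P⇔Q)

𝟙-× : {P Q : Set} (P? : Dec P) (Q? : Dec Q) → 𝟙 (P? ×-dec Q?) ≡ 𝟙 P? * 𝟙 Q?
𝟙-× (yes _) (yes _) = refl
𝟙-× (yes _) (no _)  = refl
𝟙-× (no _)  _       = refl

𝟙-≤-split : ∀ i u → 𝟙 (i ≤? u) ≡ 𝟙 (u ≟ i) + 𝟙 (suc i ≤? u)
𝟙-≤-split i u with <-cmp i u
... | tri< i<u u≢i _ =
  trans (𝟙-yes (i ≤? u) (<⇒≤ i<u)) (sym (cong₂ _+_ (𝟙-no (u ≟ i) (u≢i ∘ sym)) (𝟙-yes (suc i ≤? u) i<u)))
... | tri≈ _ refl _ =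
  trans (𝟙-yes (i ≤? i) ≤-refl) (sym (cong₂ _+_ (𝟙-yes (i ≟ i) refl) (𝟙-no (suc i ≤? i) (<-irrefl refl))))
... | tri> i≮u i≢u u<i =
  trans (𝟙-no (i ≤? u) (<⇒≱ u<i)) (sym (cong₂ _+_ (𝟙-no (u ≟ i) (i≢u ∘ sym)) (𝟙-no (suc i ≤? u) i≮u)))

𝟙-rectangle : ∀ i j u v →
  𝟙 (u ≟ i) * 𝟙 (v ≟ j) + (𝟙 (suc i ≤? u) * 𝟙 (j ≤? v) + 𝟙 (i ≤? u) * 𝟙 (suc j ≤? v)) ≡
  𝟙 (i ≤? u) * 𝟙 (j ≤? v) + 𝟙 (suc i ≤? u) * 𝟙 (suc j ≤? v)
𝟙-rectangle i j u v rewrite 𝟙-≤-split i u | 𝟙-≤-split j v =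
  solve 4 (λ a a′ b b′ → a :* b :+ (a′ :* (b :+ b′) :+ (a :+ a′) :* b′) := (a :+ a′) :* (b :+ b′) :+ a′ :* b′)
        refl (𝟙 (u ≟ i)) (𝟙 (suc i ≤? u)) (𝟙 (v ≟ j)) (𝟙 (suc j ≤? v))

𝟙↔Fin : {P : Set} → Irrelevant P → (P? : Dec P) → P ↔ Fin (𝟙 P?)
𝟙↔Fin irr (yes p) = mk↔ₛ′ (λ _ → 0F) (λ _ → p) (λ { 0F → refl ; (suc ()) }) (irr p)
𝟙↔Fin irr (no ¬p) = mk↔ₛ′ (λ p → contradiction p ¬p) (λ ()) (λ ()) (λ p → contradiction p ¬p)

Σ-Fin-suc : ∀ {N} (A : Fin (suc N) → Set) → Σ (Fin (suc N)) A ↔ (A 0F ⊎ Σ (Fin N) (A ∘ suc))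
Σ-Fin-suc A = mk↔ₛ′ (λ { (zero , x) → inj₁ x ; (suc i , x) → inj₂ (i , x) })
                    (λ { (inj₁ x) → 0F , x ; (inj₂ (i , x)) → suc i , x })
                    (λ { (inj₁ _) → refl ; (inj₂ _) → refl })
                    (λ { (zero , _) → refl ; (suc _ , _) → refl })

Σ-Fin↔sum : ∀ {N} {A : Fin N → Set} (c : Fin N → ℕ) → (∀ i → A i ↔ Fin (c i)) → Σ (Fin N) A ↔ Fin (sum c)
Σ-Fin↔sum {zero}  c A↔ = mk↔ₛ′ (λ { (() , _) }) (λ ()) (λ ()) (λ { (() , _) })
Σ-Fin↔sum {suc N} {A} c A↔ =
  ↔-trans (Σ-Fin-suc A) (↔-trans (A↔ 0F ⊎-↔ Σ-Fin↔sum (c ∘ suc) (A↔ ∘ suc)) (↔-sym +↔⊎))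

count : ∀ {N} {P : Pred (Fin N) 0ℓ} → Decidable P → ℕ
count {N} P? = ∑[ i < N ] 𝟙 (P? i)

Σ↔count : ∀ {N} {P : Pred (Fin N) 0ℓ} → (∀ i → Irrelevant (P i)) → (P? : Decidable P) → Σ (Fin N) P ↔ Fin (count P?)
Σ↔count irr P? = Σ-Fin↔sum (𝟙 ∘ P?) (λ i → 𝟙↔Fin (irr i) (P? i))

∑₂ : ∀ {N} → (Fin N × Fin N → ℕ) → ℕ
∑₂ {N} f = ∑[ a < N ] ∑[ b < N ] f (a , b)

count₂ : ∀ {N} {P : Pred (Fin N × Fin N) 0ℓ} → Decidable P → ℕ
count₂ P? = ∑₂ (𝟙 ∘ P?)

Σ↔count₂ : ∀ {N} {P : Pred (Fin N × Fin N) 0ℓ} → (∀ x → Irrelevant (P x)) → (P? : Decidable P) →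
  Σ (Fin N × Fin N) P ↔ Fin (count₂ P?)
Σ↔count₂ irr P? = ↔-trans Σ-assoc (Σ-Fin↔sum _ (λ a → Σ↔count (λ b → irr (a , b)) (λ b → P? (a , b))))

∑₂-cong : ∀ {N} {f g : Fin N × Fin N → ℕ} → (∀ x → f x ≡ g x) → ∑₂ f ≡ ∑₂ g
∑₂-cong f≗g = sum-cong-≗ (λ a → sum-cong-≗ (λ b → f≗g (a , b)))

∑₂-distrib-+ : ∀ {N} (f g : Fin N × Fin N → ℕ) → ∑₂ (λ x → f x + g x) ≡ ∑₂ f + ∑₂ g
∑₂-distrib-+ {N} f g = trans (sum-cong-≗ (λ a → ∑-distrib-+ (λ b → f (a , b)) (λ b → g (a , b))))
  (∑-distrib-+ (λ a → ∑[ b < N ] f (a , b)) (λ a → ∑[ b < N ] g (a , b)))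

∑₂-* : ∀ {N} (f g : Fin N → ℕ) → ∑₂ (λ (a , b) → f a * g b) ≡ sum f * sum g
∑₂-* f g = trans (sum-cong-≗ (λ a → sym (*-distribˡ-sum (f a) g))) (sym (*-distribʳ-sum (sum g) f))

count₂-empty : ∀ {N} {P : Pred (Fin N × Fin N) 0ℓ} (P? : Decidable P) → (∀ x → ¬ P x) → count₂ P? ≡ 0
count₂-empty {N} P? ¬P = begin
  ∑₂ (𝟙 ∘ P?)                     ≡⟨ ∑₂-cong (λ x → 𝟙-no (P? x) (¬P x)) ⟩
  ∑[ a < N ] ∑[ b < N ] 0         ≡⟨ sum-cong-≗ {N} (λ _ → sum-replicate-zero N) ⟩
  ∑[ a < N ] 0                    ≡⟨ sum-replicate-zero N ⟩
  0                               ∎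
  where open ≡-Reasoning

∣-irrelevant : ∀ {d m} .{{_ : NonZero d}} → Irrelevant (d ∣ m)
∣-irrelevant {d} (divides k e) (divides k′ e′) with *-cancelʳ-≡ k k′ d (trans (sym e) e′)
... | refl = cong (divides k) (≡-irrelevant e e′)

multiplesBelow↔ : ∀ t d .{{_ : NonZero d}} → Σ (Fin (t * d)) (λ a → d ∣ toℕ a) ↔ Fin t
multiplesBelow↔ t d = mk↔ₛ′ quotientOf multipleOf
  (λ k → fromℕ<-toℕ k _)
  multipleOf∘quotientOf
  where
  quotientOf : Σ (Fin (t * d)) (λ a → d ∣ toℕ a) → Fin t
  quotientOf (a , divides k e) = fromℕ< (*-cancelʳ-< d k t (subst (_< t * d) e (toℕ<n a)))
  multipleOf : Fin t → Σ (Fin (t * d)) (λ a → d ∣ toℕ a)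
  multipleOf k = fromℕ< (*-monoˡ-< d (toℕ<n k)) , divides (toℕ k) (toℕ-fromℕ< _)
  ≡-on-toℕ : ∀ {a a′ : Fin (t * d)} (x : d ∣ toℕ a) (y : d ∣ toℕ a′) → toℕ a ≡ toℕ a′ → (a , x) ≡ (a′ , y)
  ≡-on-toℕ x y e with toℕ-injective e
  ... | refl = cong (_ ,_) (∣-irrelevant x y)
  multipleOf∘quotientOf : ∀ x → multipleOf (quotientOf x) ≡ x
  multipleOf∘quotientOf (a , a∣@(divides k e)) = ≡-on-toℕ (proj₂ (multipleOf (quotientOf (a , a∣)))) a∣
    (trans (toℕ-fromℕ< _) (trans (cong (_* d) (toℕ-fromℕ< {m = k} _)) (sym e)))

count-multiples : ∀ {N} t d .{{_ : NonZero d}} → N ≡ t * d → count (λ (a : Fin N) → d ∣? toℕ a) ≡ t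
count-multiples t d refl =
  ↔⇒≡ (↔-trans (↔-sym (Σ↔count (λ _ → ∣-irrelevant) (λ a → d ∣? toℕ a))) (multiplesBelow↔ t d))

-- Arithmetic with truncated subtraction

∸*∸-expand : ∀ {a a′ b b′} → a′ ≤ a → b′ ≤ b → (a ∸ a′) * (b ∸ b′) + (a′ * b + a * b′) ≡ a * b + a′ * b′
∸*∸-expand {a′ = a′} {b′ = b′} a′≤a b′≤b with m≤n⇒∃[o]m+o≡n a′≤a | m≤n⇒∃[o]m+o≡n b′≤b
... | α , refl | β , refl rewrite m+n∸m≡n a′ α | m+n∸m≡n b′ β =
  solve 4 (λ a′ α b′ β → α :* β :+ (a′ :* (b′ :+ β) :+ (a′ :+ α) :* b′) := (a′ :+ α) :* (b′ :+ β) :+ a′ :* b′)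
          refl a′ α b′ β

∸*∸-unique : ∀ {e a a′ b b′} → a′ ≤ a → b′ ≤ b → e + (a′ * b + a * b′) ≡ a * b + a′ * b′ →
  e ≡ (a ∸ a′) * (b ∸ b′)
∸*∸-unique {e} {a} {a′} {b} {b′} a′≤a b′≤b e+⋯ =
  +-cancelʳ-≡ (a′ * b + a * b′) e ((a ∸ a′) * (b ∸ b′)) (trans e+⋯ (sym (∸*∸-expand a′≤a b′≤b)))

∸∸+-unique : ∀ {e a x y d} → e + (x + y) ≡ a + d → x + y ≤ a → e ≡ a ∸ x ∸ y + d
∸∸+-unique {e} {a} {x} {y} {d} e+⋯ x+y≤a = +-cancelʳ-≡ (x + y) e (a ∸ x ∸ y + d) (begin
  e + (x + y)                    ≡⟨ e+⋯ ⟩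
  a + d                          ≡⟨ cong (_+ d) (sym (m∸n+n≡m x+y≤a)) ⟩
  a ∸ (x + y) + (x + y) + d      ≡⟨ solve 3 (λ r s d → r :+ s :+ d := r :+ d :+ s) refl (a ∸ (x + y)) (x + y) d ⟩
  a ∸ (x + y) + d + (x + y)      ≡⟨ cong (λ r → r + d + (x + y)) (sym (∸-+-assoc a x y)) ⟩
  a ∸ x ∸ y + d + (x + y)        ∎)
  where open ≡-Reasoning

x+y≤x*y : ∀ {x y} → 2 ≤ x → 2 ≤ y → x + y ≤ x * y
x+y≤x*y {suc (suc x)} {suc (suc y)} (s≤s (s≤s _)) (s≤s (s≤s _)) = subst (2 + x + (2 + y) ≤_)
  (solve 2 (λ x y → con 2 :+ x :+ (con 2 :+ y) :+ (x :+ y :+ x :* y) := (con 2 :+ x) :* (con 2 :+ y)) refl x y)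
  (m≤m+n (2 + x + (2 + y)) (x + y + x * y))

∸*∸≡∸∸+ : ∀ a a′ b b′ x y → a′ ≤ a → b′ ≤ b → x + y ≡ a′ * b + a * b′ → x + y ≤ a * b →
  (a ∸ a′) * (b ∸ b′) ≡ a * b ∸ x ∸ y + a′ * b′
∸*∸≡∸∸+ a a′ b b′ x y a′≤a b′≤b x+y≡ x+y≤ab =
  ∸∸+-unique {x = x} {y = y} (trans (cong ((a ∸ a′) * (b ∸ b′) +_) x+y≡) (∸*∸-expand a′≤a b′≤b)) x+y≤ab

-- Divisors of p ^ a * q ^ b

2≤prime² : ∀ {r} → Prime r → 2 ≤ r ^ 2
2≤prime² {r} r-prime =
  ≤-trans (nonTrivial⇒n>1 r {{prime⇒nonTrivial r-prime}}) (m≤m*n r (r ^ 1) {{m^n≢0 r 1 {{prime⇒nonZero r-prime}}}})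

prime∤⇒coprime : ∀ {p n} → Prime p → ¬ p ∣ n → Coprime p n
prime∤⇒coprime p-prime p∤n (c∣p , c∣n) with prime⇒irreducible p-prime c∣p
... | inj₁ c≡1  = c≡1
... | inj₂ refl = contradiction c∣n p∤n

∣p^a*m⇒≡p^u*h : ∀ {p g m} → Prime p → ∀ a → g ∣ p ^ a * m → ∃₂ λ u h → u ≤ a × h ∣ m × g ≡ p ^ u * h
∣p^a*m⇒≡p^u*h {g = g} {m} p-prime zero g∣m = 0 , g , z≤n , subst (g ∣_) (+-identityʳ m) g∣m , sym (+-identityʳ g)
∣p^a*m⇒≡p^u*h {p} {g} {m} p-prime (suc a) g∣ with p ∣? g
... | yes (divides g′ refl) with ∣p^a*m⇒≡p^u*h p-prime a
      (*-cancelˡ-∣ p {{prime⇒nonZero p-prime}} (subst₂ _∣_ (*-comm g′ p) (*-assoc p (p ^ a) m) g∣))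
...   | u , h , u≤a , h∣m , refl =
  suc u , h , s≤s u≤a , h∣m , solve 3 (λ p pᵘ h → pᵘ :* h :* p := (p :* pᵘ) :* h) refl p (p ^ u) h
∣p^a*m⇒≡p^u*h {p} {g} {m} p-prime (suc a) g∣ | no p∤g with ∣p^a*m⇒≡p^u*h p-prime a
      (coprime-divisor (Coprime.sym (prime∤⇒coprime p-prime p∤g)) (subst (g ∣_) (*-assoc p (p ^ a) m) g∣))
...   | u , h , u≤a , h∣m , g≡ = u , h , m≤n⇒m≤1+n u≤a , h∣m , g≡

∣p^a*q^b⇒≡p^u*q^v : ∀ {p q g} a b → Prime p → Prime q → g ∣ p ^ a * q ^ b →
  ∃₂ λ u v → u ≤ a × v ≤ b × g ≡ p ^ u * q ^ v
∣p^a*q^b⇒≡p^u*q^v {p} {q} a b p-prime q-prime g∣ with ∣p^a*m⇒≡p^u*h p-prime a g∣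
... | u , h , u≤a , h∣qᵇ , refl with ∣p^a*m⇒≡p^u*h q-prime b (subst (h ∣_) (sym (*-identityʳ (q ^ b))) h∣qᵇ)
...   | v , k , v≤b , k∣1 , refl =
  u , v , u≤a , v≤b , cong (p ^ u *_) (trans (cong (q ^ v *_) (∣1⇒≡1 k∣1)) (*-identityʳ (q ^ v)))

prime∤prime^ : ∀ {p q} → Prime p → Prime q → p ≢ q → ∀ v → ¬ p ∣ q ^ v
prime∤prime^ p-prime q-prime p≢q zero    p∣1 = nonTrivial⇒≢1 {{prime⇒nonTrivial p-prime}} (∣1⇒≡1 p∣1)
prime∤prime^ {q = q} p-prime q-prime p≢q (suc v) p∣qᵛ⁺¹ with euclidsLemma q (q ^ v) p-prime p∣qᵛ⁺¹
... | inj₁ p∣q  = [ nonTrivial⇒≢1 {{prime⇒nonTrivial p-prime}} , p≢q ]′ (prime⇒irreducible q-prime p∣q)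
... | inj₂ p∣qᵛ = prime∤prime^ p-prime q-prime p≢q v p∣qᵛ

^-monoʳ-∣ : ∀ p {i u} → i ≤ u → p ^ i ∣ p ^ u
^-monoʳ-∣ p {i} {u} i≤u =
  divides (p ^ (u ∸ i)) (trans (cong (p ^_) (sym (m∸n+n≡m i≤u))) (^-distribˡ-+-* p (u ∸ i) i))

p^i*m∣p^u*q^v⇒i≤u : ∀ {p q} → Prime p → Prime q → p ≢ q → ∀ i u m v → p ^ i * m ∣ p ^ u * q ^ v → i ≤ u
p^i*m∣p^u*q^v⇒i≤u p-prime q-prime p≢q zero    u       _ _ _ = z≤n
p^i*m∣p^u*q^v⇒i≤u {p} {q} p-prime q-prime p≢q (suc i) zero m v ∣qᵛ =
  contradiction (∣-trans (∣m⇒∣m*n m (m∣m*n (p ^ i))) (subst (p ^ suc i * m ∣_) (*-identityˡ (q ^ v)) ∣qᵛ))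
                (prime∤prime^ p-prime q-prime p≢q v)
p^i*m∣p^u*q^v⇒i≤u {p} {q} p-prime q-prime p≢q (suc i) (suc u) m v ∣ =
  s≤s (p^i*m∣p^u*q^v⇒i≤u p-prime q-prime p≢q i u m v
        (*-cancelˡ-∣ p {{prime⇒nonZero p-prime}} (subst₂ _∣_ (*-assoc p (p ^ i) m) (*-assoc p (p ^ u) (q ^ v)) ∣)))

p^i*q^j∣p^u*q^v⇔ : ∀ {p q} → Prime p → Prime q → p ≢ q → ∀ i j u v →
  p ^ i * q ^ j ∣ p ^ u * q ^ v ⇔ (i ≤ u × j ≤ v)
p^i*q^j∣p^u*q^v⇔ {p} {q} p-prime q-prime p≢q i j u v = mk⇔
  (λ ∣ → p^i*m∣p^u*q^v⇒i≤u p-prime q-prime p≢q i u (q ^ j) v ∣ ,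
         p^i*m∣p^u*q^v⇒i≤u q-prime p-prime (p≢q ∘ sym) j v (p ^ i) u
           (subst₂ _∣_ (*-comm (p ^ i) (q ^ j)) (*-comm (p ^ u) (q ^ v)) ∣))
  (λ (i≤u , j≤v) → *-pres-∣ (^-monoʳ-∣ p i≤u) (^-monoʳ-∣ q j≤v))

p^i*q^j-injective : ∀ {p q} → Prime p → Prime q → p ≢ q → ∀ i j u v →
  p ^ i * q ^ j ≡ p ^ u * q ^ v → i ≡ u × j ≡ v
p^i*q^j-injective {p} {q} p-prime q-prime p≢q i j u v e =
  ≤-antisym (proj₁ (exponents-≤ i j u v e)) (proj₁ (exponents-≤ u v i j (sym e))) ,
  ≤-antisym (proj₂ (exponents-≤ i j u v e)) (proj₂ (exponents-≤ u v i j (sym e)))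
  where
  exponents-≤ : ∀ i j u v → p ^ i * q ^ j ≡ p ^ u * q ^ v → i ≤ u × j ≤ v
  exponents-≤ i j u v e = Equivalence.to (p^i*q^j∣p^u*q^v⇔ p-prime q-prime p≢q i j u v) (∣-reflexive e)

-- Subgroups of cyclic groups

record DivisorEnumeration (n : ℕ) (I : Set) : Set where
  field
    divisor            : I → ℕ
    divisor∣n          : ∀ i → divisor i ∣ n
    divisor-injective  : ∀ {i j} → divisor i ≡ divisor j → i ≡ j
    divisor-surjective : ∀ {d} → d ∣ n → Σ I (λ i → divisor i ≡ d)

  classOf : ∀ {d} → d ∣ n → I
  classOf d∣n = proj₁ (divisor-surjective d∣n)

  divisor-classOf : ∀ {d} (d∣n : d ∣ n) → divisor (classOf d∣n) ≡ d
  divisor-classOf d∣n = proj₂ (divisor-surjective d∣n)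

  classOf≡⇔ : ∀ {d} (d∣n : d ∣ n) {i} → classOf d∣n ≡ i ⇔ d ≡ divisor i
  classOf≡⇔ d∣n = mk⇔ (λ { refl → sym (divisor-classOf d∣n) }) (λ { refl → divisor-injective (divisor-classOf d∣n) })

generatorGcd : ∀ {n} → Fin n × Fin n → ℕ
generatorGcd {n} (a , b) = gcd n (gcd (toℕ a) (toℕ b))

generatorGcd∣n : ∀ {n} (x : Fin n × Fin n) → generatorGcd x ∣ n
generatorGcd∣n {n} (a , b) = gcd[m,n]∣m n (gcd (toℕ a) (toℕ b))

∣generatorGcd⇔ : ∀ {n d} {a b : Fin n} → d ∣ n → d ∣ generatorGcd (a , b) ⇔ (d ∣ toℕ a × d ∣ toℕ b)
∣generatorGcd⇔ {n} {a = a} {b = b} d∣n = mk⇔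
  (λ d∣g → let d∣ab = ∣-trans d∣g (gcd[m,n]∣n n (gcd (toℕ a) (toℕ b)))
           in ∣-trans d∣ab (gcd[m,n]∣m (toℕ a) (toℕ b)) , ∣-trans d∣ab (gcd[m,n]∣n (toℕ a) (toℕ b)))
  (λ (d∣a , d∣b) → gcd-greatest d∣n (gcd-greatest d∣a d∣b))

generatorClass : ∀ {n I} → DivisorEnumeration n I → Fin n × Fin n → I
generatorClass E x = DivisorEnumeration.classOf E (generatorGcd∣n x)

gcdAll : ∀ {k} → (Fin k → ℕ) → ℕ
gcdAll {zero}  f = 0
gcdAll {suc k} f = gcd (f 0F) (gcdAll (f ∘ suc))

gcdAll∣ : ∀ {k} (f : Fin k → ℕ) i → gcdAll f ∣ f i
gcdAll∣ f zero    = gcd[m,n]∣m (f 0F) (gcdAll (f ∘ suc))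
gcdAll∣ f (suc i) = ∣-trans (gcd[m,n]∣n (f 0F) (gcdAll (f ∘ suc))) (gcdAll∣ (f ∘ suc) i)

∣gcdAll : ∀ {k c} (f : Fin k → ℕ) → (∀ i → c ∣ f i) → c ∣ gcdAll f
∣gcdAll {zero} {c} f c∣f = c ∣0
∣gcdAll {suc k} f c∣f = gcd-greatest (c∣f 0F) (∣gcdAll (f ∘ suc) (c∣f ∘ suc))

-- ℤ/nℤ with n = suc m, so that _⊕_ computes.
module CyclicGroup (m : ℕ) where

  n : ℕ
  n = suc m

  _∈ᵣ_ : ℕ → Subset n → Set
  x ∈ᵣ S = x mod n ∈ S

  toℕ-mod : ∀ x → toℕ (x mod n) ≡ x % n
  toℕ-mod x = toℕ-fromℕ< (m%n<n x n)

  mod-cong : ∀ x y → x % n ≡ y % n → x mod n ≡ y mod n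
  mod-cong x y e = toℕ-injective (trans (toℕ-mod x) (trans e (sym (toℕ-mod y))))

  toℕ-mod-id : ∀ (i : Fin n) → toℕ i mod n ≡ i
  toℕ-mod-id i = toℕ-injective (trans (toℕ-mod (toℕ i)) (m<n⇒m%n≡m (toℕ<n i)))

  ⊕-mod : ∀ x y → (x mod n) ⊕ (y mod n) ≡ (x + y) mod n
  ⊕-mod x y = toℕ-injective (trans (toℕ-mod (toℕ (x mod n) + toℕ (y mod n)))
    (trans (cong₂ (λ a b → (a + b) % n) (toℕ-mod x) (toℕ-mod y))
           (trans (sym (%-distribˡ-+ x y n)) (sym (toℕ-mod (x + y))))))

  module _ {S : Subset n} (S≤ : IsSubgroup S) where

    0∈ᵣ : 0 ∈ᵣ S
    0∈ᵣ = proj₁ S≤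

    ∈ᵣ-+ : ∀ x y → x ∈ᵣ S → y ∈ᵣ S → (x + y) ∈ᵣ S
    ∈ᵣ-+ x y x∈ y∈ = subst (_∈ S) (⊕-mod x y) (proj₁ (proj₂ S≤) (x mod n) (y mod n) x∈ y∈)

    ∈ᵣ-* : ∀ k x → x ∈ᵣ S → (k * x) ∈ᵣ S
    ∈ᵣ-* zero    x x∈ = 0∈ᵣ
    ∈ᵣ-* (suc k) x x∈ = ∈ᵣ-+ x (k * x) x∈ (∈ᵣ-* k x x∈)

    -- Subtracting y is adding (n - 1) * y = m * y.
    ∈ᵣ-cancel : ∀ x y → (x + y) ∈ᵣ S → y ∈ᵣ S → x ∈ᵣ S
    ∈ᵣ-cancel x y x+y∈ y∈ =
      subst (_∈ S) (mod-cong (x + y + m * y) x x+y+my≡x) (∈ᵣ-+ (x + y) (m * y) x+y∈ (∈ᵣ-* m y y∈))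
      where
      x+y+my≡x : (x + y + m * y) % n ≡ x % n
      x+y+my≡x = trans (cong (_% n) (trans (+-assoc x y (m * y)) (cong (x +_) (*-comm n y)))) ([m+kn]%n≡m%n x y n)

    ∈ᵣ-gcd : ∀ x y → x ∈ᵣ S → y ∈ᵣ S → gcd x y ∈ᵣ S
    ∈ᵣ-gcd x y x∈ y∈ with Bézout.identity (gcd-GCD x y)
    ... | Bézout.+- a b eq = ∈ᵣ-cancel (gcd x y) (b * y) (subst (_∈ᵣ S) (sym eq) (∈ᵣ-* a x x∈)) (∈ᵣ-* b y y∈)
    ... | Bézout.-+ a b eq = ∈ᵣ-cancel (gcd x y) (a * x) (subst (_∈ᵣ S) (sym eq) (∈ᵣ-* b y y∈)) (∈ᵣ-* a x x∈)

    n∈ᵣ : n ∈ᵣ S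
    n∈ᵣ = subst (_∈ S) (mod-cong 0 n (sym (n%n≡0 n))) 0∈ᵣ

    ∈⇒∈ᵣ : ∀ {i} → i ∈ S → toℕ i ∈ᵣ S
    ∈⇒∈ᵣ {i} = subst (_∈ S) (sym (toℕ-mod-id i))

    ∈ᵣ⇒∈ : ∀ {i} → toℕ i ∈ᵣ S → i ∈ S
    ∈ᵣ⇒∈ {i} = subst (_∈ S) (toℕ-mod-id i)

    ∈ᵣ-gcdAll : ∀ {k} (f : Fin k → ℕ) → (∀ i → f i ∈ᵣ S) → gcdAll f ∈ᵣ S
    ∈ᵣ-gcdAll {zero}  f f∈ = 0∈ᵣ
    ∈ᵣ-gcdAll {suc k} f f∈ = ∈ᵣ-gcd (f 0F) (gcdAll (f ∘ suc)) (f∈ 0F) (∈ᵣ-gcdAll (f ∘ suc) (f∈ ∘ suc))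

  multiples : ℕ → Subset n
  multiples d = tabulate (λ i → ⌊ d ∣? toℕ i ⌋)

  ∈-multiples⇔ : ∀ d i → i ∈ multiples d ⇔ d ∣ toℕ i
  ∈-multiples⇔ d i = mk⇔
    (λ i∈ → toWitness (Equivalence.from T-≡ (trans (sym (lookup∘tabulate f i)) ([]=⇒lookup i∈))))
    (λ d∣i → lookup⇒[]= i (multiples d) (trans (lookup∘tabulate f i) (Equivalence.to T-≡ (fromWitness d∣i))))
    where
    f : Fin n → Bool
    f i = ⌊ d ∣? toℕ i ⌋

  ∈ᵣ-multiples⇔ : ∀ {d} → d ∣ n → ∀ x → x ∈ᵣ multiples d ⇔ d ∣ x
  ∈ᵣ-multiples⇔ {d} d∣n x = mk⇔
    (λ x∈ → ∣n∣m%n⇒∣m d∣n (subst (d ∣_) (toℕ-mod x) (Equivalence.to (∈-multiples⇔ d (x mod n)) x∈)))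
    (λ d∣x → Equivalence.from (∈-multiples⇔ d (x mod n)) (subst (d ∣_) (sym (toℕ-mod x)) (%-presˡ-∣ d∣x d∣n)))

  multiples-isSubgroup : ∀ {d} → d ∣ n → IsSubgroup (multiples d)
  multiples-isSubgroup {d} d∣n =
    from (∈-multiples⇔ d 0F) (d ∣0) ,
    (λ i j i∈ j∈ → from (∈ᵣ-multiples⇔ d∣n (toℕ i + toℕ j))
                        (∣m∣n⇒∣m+n (to (∈-multiples⇔ d i) i∈) (to (∈-multiples⇔ d j) j∈))) ,
    (λ i i∈ → from (∈ᵣ-multiples⇔ d∣n (n ∸ toℕ i))
                   (∣m+n∣m⇒∣n (subst (d ∣_) (sym (m+[n∸m]≡n (<⇒≤ (toℕ<n i)))) d∣n) (to (∈-multiples⇔ d i) i∈)))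
    where open Equivalence

  multiples-⊆ : ∀ {S : Subset n} {d} → IsSubgroup S → d ∈ᵣ S → multiples d ⊆ S
  multiples-⊆ {S} {d} S≤ d∈ {i} i∈ with Equivalence.to (∈-multiples⇔ d i) i∈
  ... | divides k e = ∈ᵣ⇒∈ S≤ (subst (_∈ᵣ S) (sym e) (∈ᵣ-* S≤ k d d∈))

  elementOrZero : Subset n → Fin n → ℕ
  elementOrZero S i with i ∈? S
  ... | yes _ = toℕ i
  ... | no  _ = 0

  index : Subset n → ℕ
  index S = gcd n (gcdAll (elementOrZero S))

  index∣n : ∀ S → index S ∣ n
  index∣n S = gcd[m,n]∣m n (gcdAll (elementOrZero S))

  index∣element : ∀ {S : Subset n} {i} → i ∈ S → index S ∣ toℕ i
  index∣element {S} {i} i∈S = ∣-trans (gcd[m,n]∣n n (gcdAll (elementOrZero S)))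
    (subst (gcdAll (elementOrZero S) ∣_) element≡ (gcdAll∣ (elementOrZero S) i))
    where
    element≡ : elementOrZero S i ≡ toℕ i
    element≡ with i ∈? S
    ... | yes _   = refl
    ... | no i∉S = contradiction i∈S i∉S

  index∈ᵣ : ∀ {S : Subset n} → IsSubgroup S → index S ∈ᵣ S
  index∈ᵣ {S} S≤ = ∈ᵣ-gcd S≤ n (gcdAll (elementOrZero S)) (n∈ᵣ S≤) (∈ᵣ-gcdAll S≤ (elementOrZero S) element∈ᵣ)
    where
    element∈ᵣ : ∀ i → elementOrZero S i ∈ᵣ S
    element∈ᵣ i with i ∈? S
    ... | yes i∈S = ∈⇒∈ᵣ S≤ i∈S
    ... | no  _   = 0∈ᵣ S≤

  subgroup≡multiples-index : ∀ {S : Subset n} → IsSubgroup S → S ≡ multiples (index S)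
  subgroup≡multiples-index {S} S≤ =
    ⊆-antisym (λ {i} i∈S → Equivalence.from (∈-multiples⇔ (index S) i) (index∣element i∈S))
              (multiples-⊆ S≤ (index∈ᵣ S≤))

  index-multiples : ∀ {d} → d ∣ n → index (multiples d) ≡ d
  index-multiples {d} d∣n = ∣-antisym index∣d d∣index
    where
    index∣d : index (multiples d) ∣ d
    index∣d = ∣n∣m%n⇒∣m (index∣n (multiples d))
      (subst (index (multiples d) ∣_) (toℕ-mod d) (index∣element (Equivalence.from (∈ᵣ-multiples⇔ d∣n d) ∣-refl)))
    d∣element : ∀ i → d ∣ elementOrZero (multiples d) i
    d∣element i with i ∈? multiples d
    ... | yes i∈ = Equivalence.to (∈-multiples⇔ d i) i∈
    ... | no  _  = d ∣0
    d∣index : d ∣ index (multiples d)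
    d∣index = gcd-greatest d∣n (∣gcdAll (elementOrZero (multiples d)) d∣element)

  multiples-generatorGcd-isGeneratedBy : ∀ a b → IsGeneratedBy (multiples (generatorGcd (a , b))) a b
  multiples-generatorGcd-isGeneratedBy a b =
    Equivalence.from (∈-multiples⇔ g a) (proj₁ g∣a×g∣b) ,
    Equivalence.from (∈-multiples⇔ g b) (proj₂ g∣a×g∣b) ,
    λ K K≤ a∈ b∈ → multiples-⊆ K≤
      (∈ᵣ-gcd K≤ n (gcd (toℕ a) (toℕ b)) (n∈ᵣ K≤) (∈ᵣ-gcd K≤ (toℕ a) (toℕ b) (∈⇒∈ᵣ K≤ a∈) (∈⇒∈ᵣ K≤ b∈)))
    where
    g : ℕ
    g = generatorGcd (a , b)
    g∣a×g∣b : g ∣ toℕ a × g ∣ toℕ b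
    g∣a×g∣b = Equivalence.to (∣generatorGcd⇔ (generatorGcd∣n (a , b))) ∣-refl

  isGeneratedBy-unique : ∀ {H H′ : Subset n} {a b : Fin n} → IsSubgroup H → IsSubgroup H′ →
    IsGeneratedBy H a b → IsGeneratedBy H′ a b → H ≡ H′
  isGeneratedBy-unique {H} {H′} H≤ H′≤ (a∈H , b∈H , H-least) (a∈H′ , b∈H′ , H′-least) =
    ⊆-antisym (H-least H′ H′≤ a∈H′ b∈H′) (H′-least H H≤ a∈H b∈H)

  isGeneratedBy⇔ : ∀ {H : Subset n} {a b : Fin n} → IsSubgroup H →
    IsGeneratedBy H a b ⇔ generatorGcd (a , b) ≡ index H
  isGeneratedBy⇔ {H} {a} {b} H≤ = mk⇔
    (λ gen → sym (trans (cong index (isGeneratedBy-unique H≤ (multiples-isSubgroup g∣n) gen generates))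
                        (index-multiples {g} g∣n)))
    (λ g≡index → subst (λ K → IsGeneratedBy K a b)
                       (sym (trans (subgroup≡multiples-index H≤) (cong multiples (sym g≡index))))
                       generates)
    where
    g : ℕ
    g = generatorGcd (a , b)
    g∣n : g ∣ n
    g∣n = generatorGcd∣n (a , b)
    generates : IsGeneratedBy (multiples g) a b
    generates = multiples-generatorGcd-isGeneratedBy a b

  module _ {I : Set} (E : DivisorEnumeration n I) where
    open DivisorEnumeration E

    subgroupClass : L n → I
    subgroupClass (H , _) = classOf (index∣n H)

    subgroups↔ : L n ↔ I
    subgroups↔ = mk↔ₛ′ subgroupClass subgroupOf
      (λ i → Equivalence.from (classOf≡⇔ (index∣n (multiples (divisor i)))) (index-multiples (divisor∣n i)))
      (λ (H , t) → L-≡ (proj₂ (subgroupOf (subgroupClass (H , t)))) t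
         (trans (cong multiples (divisor-classOf (index∣n H))) (sym (subgroup≡multiples-index (toWitness t)))))
      where
      subgroupOf : I → L n
      subgroupOf i = multiples (divisor i) , fromWitness (multiples-isSubgroup (divisor∣n i))
      L-≡ : ∀ {H H′ : Subset n} (t : True (isSubgroup? H)) (t′ : True (isSubgroup? H′)) → H ≡ H′ → (H , t) ≡ (H′ , t′)
      L-≡ t t′ refl = cong (_ ,_) (T-irrelevant t t′)

    SGB≅functionGraph : SGB n ≅ FunctionGraph (generatorClass E)
    SGB≅functionGraph = record
      { f   = ↔-refl ⊎-↔ subgroups↔
      ; adj = λ { (inj₁ _)       (inj₁ _)       → ⇔.refl
                ; (inj₁ (a , b)) (inj₂ H)       → generates⇔ a b H
                ; (inj₂ H)       (inj₁ (a , b)) → generates⇔ a b H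
                ; (inj₂ _)       (inj₂ _)       → ⇔.refl }
      }
      where
      generates⇔ : ∀ a b (H : L n) → IsGeneratedBy (proj₁ H) a b ⇔ generatorClass E (a , b) ≡ subgroupClass H
      generates⇔ a b (H , t) = ⇔.trans (isGeneratedBy⇔ (toWitness t))
        (subst (λ d → (generatorGcd (a , b) ≡ d) ⇔ (generatorClass E (a , b) ≡ subgroupClass (H , t)))
               (divisor-classOf (index∣n H)) (⇔.sym (classOf≡⇔ (generatorGcd∣n (a , b)))))

SGB≅functionGraph : ∀ {n I} .{{_ : NonZero n}} (E : DivisorEnumeration n I) → SGB n ≅ FunctionGraph (generatorClass E)
SGB≅functionGraph {suc m} = CyclicGroup.SGB≅functionGraph m

generatorClass-fibre↔ : ∀ {n k} (E : DivisorEnumeration n (Fin k)) (i : Fin k) →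
  Σ (Fin n × Fin n) (λ x → generatorClass E x ≡ i) ↔
  Fin (count₂ (λ (x : Fin n × Fin n) → generatorGcd x ≟ DivisorEnumeration.divisor E i))
generatorClass-fibre↔ {n} E i = subst (λ c → Σ (Fin n × Fin n) (λ x → generatorClass E x ≡ i) ↔ Fin c)
  (∑₂-cong {n} (λ x →
    𝟙-cong (generatorClass E x Fin.≟ i) (generatorGcd x ≟ divisor i) (classOf≡⇔ (generatorGcd∣n x))))
  (Σ↔count₂ (λ x → Decidable⇒UIP.≡-irrelevant Fin._≟_) (λ x → generatorClass E x Fin.≟ i))
  where open DivisorEnumeration E

-- The cyclic group of order p²q²

-- The exponents (i, j) of the divisors p ^ i * q ^ j, listed in the order of the stars in the theorem.
exponents : Fin 9 → ℕ × ℕ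
exponents 0F = 2 , 2
exponents 1F = 1 , 2
exponents 2F = 0 , 2
exponents 3F = 2 , 1
exponents 4F = 2 , 0
exponents 5F = 1 , 1
exponents 6F = 1 , 0
exponents 7F = 0 , 1
exponents 8F = 0 , 0

exponents-≤2 : ∀ k → proj₁ (exponents k) ≤ 2 × proj₂ (exponents k) ≤ 2
exponents-≤2 = from-yes (Fin.all? λ k → proj₁ (exponents k) ≤? 2 ×-dec proj₂ (exponents k) ≤? 2)

exponents-injective : ∀ {k l} → exponents k ≡ exponents l → k ≡ l
exponents-injective {k} {l} =
  from-yes (Fin.all? λ k → Fin.all? λ l → ≡-dec _≟_ _≟_ (exponents k) (exponents l) →-dec k Fin.≟ l) k l

exponents-surjective : ∀ {u v} → u ≤ 2 → v ≤ 2 → ∃ λ k → exponents k ≡ (u , v)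
exponents-surjective {0} {0} _ _ = 8F , refl
exponents-surjective {0} {1} _ _ = 7F , refl
exponents-surjective {0} {2} _ _ = 2F , refl
exponents-surjective {1} {0} _ _ = 6F , refl
exponents-surjective {1} {1} _ _ = 5F , refl
exponents-surjective {1} {2} _ _ = 1F , refl
exponents-surjective {2} {0} _ _ = 4F , refl
exponents-surjective {2} {1} _ _ = 3F , refl
exponents-surjective {2} {2} _ _ = 0F , refl
exponents-surjective {suc (suc (suc _))} (s≤s (s≤s ())) _
exponents-surjective {_} {suc (suc (suc _))} _ (s≤s (s≤s ()))

cofactorSquare : ℕ → ℕ → ℕ
cofactorSquare p 0 = p ^ 4
cofactorSquare p 1 = p ^ 2
cofactorSquare p 2 = 1
cofactorSquare p (suc (suc (suc _))) = 0

cofactorSquare-antitone : ∀ p .{{_ : NonZero p}} i → cofactorSquare p (suc i) ≤ cofactorSquare p i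
cofactorSquare-antitone p 0 = ^-monoʳ-≤ p {2} {4} (s≤s (s≤s z≤n))
cofactorSquare-antitone p 1 = m^n>0 p 2
cofactorSquare-antitone p 2 = z≤n
cofactorSquare-antitone p (suc (suc (suc _))) = z≤n

cofactorSquare≡ : ∀ p {i} → i ≤ 2 → cofactorSquare p i ≡ p ^ (2 ∸ i) * p ^ (2 ∸ i)
cofactorSquare≡ p {0} _ = solve 1 (λ p → p :^ 4 := p :^ 2 :* p :^ 2) refl p
cofactorSquare≡ p {1} _ = solve 1 (λ p → p :^ 2 := p :^ 1 :* p :^ 1) refl p
cofactorSquare≡ p {2} _ = refl
cofactorSquare≡ p {suc (suc (suc _))} (s≤s (s≤s ()))

cofactorSquare-beyond : ∀ p {i} → 2 < i → cofactorSquare p i ≡ 0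
cofactorSquare-beyond p (s≤s (s≤s (s≤s _))) = refl

leafCount : ℕ → ℕ → Fin 9 → ℕ
leafCount p q 0F = 1
leafCount p q 1F = p ^ 2 ∸ 1
leafCount p q 2F = p ^ 4 ∸ p ^ 2
leafCount p q 3F = q ^ 2 ∸ 1
leafCount p q 4F = q ^ 4 ∸ q ^ 2
leafCount p q 5F = p ^ 2 * q ^ 2 ∸ p ^ 2 ∸ q ^ 2 + 1
leafCount p q 6F = p ^ 2 * q ^ 4 ∸ p ^ 2 * q ^ 2 ∸ q ^ 4 + q ^ 2
leafCount p q 7F = p ^ 4 * q ^ 2 ∸ p ^ 2 * q ^ 2 ∸ p ^ 4 + p ^ 2
leafCount p q 8F = p ^ 4 * q ^ 4 ∸ p ^ 2 * q ^ 4 ∸ p ^ 4 * q ^ 2 + p ^ 2 * q ^ 2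

module ProductOfTwoPrimeSquares {p q : ℕ} (p-prime : Prime p) (q-prime : Prime q) (p≢q : p ≢ q) where

  private instance
    p≢0 : NonZero p
    p≢0 = prime⇒nonZero p-prime
    q≢0 : NonZero q
    q≢0 = prime⇒nonZero q-prime

  n : ℕ
  n = p ^ 2 * q ^ 2

  instance
    n≢0 : NonZero n
    n≢0 = m*n≢0 (p ^ 2) (q ^ 2) {{m^n≢0 p 2}} {{m^n≢0 q 2}}

  divisors : DivisorEnumeration n (Fin 9)
  divisors = record
    { divisor            = divisor
    ; divisor∣n          = λ k → Equivalence.from (p^i*q^j∣p^u*q^v⇔ p-prime q-prime p≢q (i k) (j k) 2 2) (exponents-≤2 k)
    ; divisor-injective  = λ {k} {l} e →
        exponents-injective (×-≡,≡→≡ (p^i*q^j-injective p-prime q-prime p≢q (i k) (j k) (i l) (j l) e))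
    ; divisor-surjective = surjective
    }
    where
    i j : Fin 9 → ℕ
    i = proj₁ ∘ exponents
    j = proj₂ ∘ exponents
    divisor : Fin 9 → ℕ
    divisor k = p ^ i k * q ^ j k
    surjective : ∀ {d} → d ∣ n → ∃ λ k → divisor k ≡ d
    surjective d∣n with ∣p^a*q^b⇒≡p^u*q^v 2 2 p-prime q-prime d∣n
    ... | u , v , u≤2 , v≤2 , refl with exponents-surjective u≤2 v≤2
    ...   | k , e = k , cong (λ (i , j) → p ^ i * q ^ j) e

  exact : ℕ → ℕ → ℕ
  exact i j = count₂ (λ (x : Fin n × Fin n) → generatorGcd x ≟ p ^ i * q ^ j)

  divisible : ℕ → ℕ → ℕ
  divisible i j = count₂ (λ (x : Fin n × Fin n) → p ^ i * q ^ j ∣? generatorGcd x)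

  𝟙-∣ : ∀ i j u v → 𝟙 (p ^ i * q ^ j ∣? p ^ u * q ^ v) ≡ 𝟙 (i ≤? u) * 𝟙 (j ≤? v)
  𝟙-∣ i j u v = trans (𝟙-cong (p ^ i * q ^ j ∣? p ^ u * q ^ v) (i ≤? u ×-dec j ≤? v)
                              (p^i*q^j∣p^u*q^v⇔ p-prime q-prime p≢q i j u v))
                      (𝟙-× (i ≤? u) (j ≤? v))

  𝟙-≡ : ∀ i j u v → 𝟙 (p ^ u * q ^ v ≟ p ^ i * q ^ j) ≡ 𝟙 (u ≟ i) * 𝟙 (v ≟ j)
  𝟙-≡ i j u v = trans (𝟙-cong (p ^ u * q ^ v ≟ p ^ i * q ^ j) (u ≟ i ×-dec v ≟ j)
                              (mk⇔ (p^i*q^j-injective p-prime q-prime p≢q u v i j) λ { (refl , refl) → refl }))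
                      (𝟙-× (u ≟ i) (v ≟ j))

  inclusion-exclusion-at : ∀ i j {g} → g ∣ n →
    𝟙 (g ≟ p ^ i * q ^ j) + (𝟙 (p ^ suc i * q ^ j ∣? g) + 𝟙 (p ^ i * q ^ suc j ∣? g)) ≡
    𝟙 (p ^ i * q ^ j ∣? g) + 𝟙 (p ^ suc i * q ^ suc j ∣? g)
  inclusion-exclusion-at i j g∣n with ∣p^a*q^b⇒≡p^u*q^v 2 2 p-prime q-prime g∣n
  ... | u , v , _ , _ , refl = begin
    𝟙 (p ^ u * q ^ v ≟ p ^ i * q ^ j) + (𝟙 (p ^ suc i * q ^ j ∣? p ^ u * q ^ v) + 𝟙 (p ^ i * q ^ suc j ∣? p ^ u * q ^ v))
      ≡⟨ cong₂ _+_ (𝟙-≡ i j u v) (cong₂ _+_ (𝟙-∣ (suc i) j u v) (𝟙-∣ i (suc j) u v)) ⟩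
    𝟙 (u ≟ i) * 𝟙 (v ≟ j) + (𝟙 (suc i ≤? u) * 𝟙 (j ≤? v) + 𝟙 (i ≤? u) * 𝟙 (suc j ≤? v))
      ≡⟨ 𝟙-rectangle i j u v ⟩
    𝟙 (i ≤? u) * 𝟙 (j ≤? v) + 𝟙 (suc i ≤? u) * 𝟙 (suc j ≤? v)
      ≡⟨ cong₂ _+_ (𝟙-∣ i j u v) (𝟙-∣ (suc i) (suc j) u v) ⟨
    𝟙 (p ^ i * q ^ j ∣? p ^ u * q ^ v) + 𝟙 (p ^ suc i * q ^ suc j ∣? p ^ u * q ^ v) ∎
    where open ≡-Reasoning

  inclusion-exclusion : ∀ i j →
    exact i j + (divisible (suc i) j + divisible i (suc j)) ≡ divisible i j + divisible (suc i) (suc j)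
  inclusion-exclusion i j = begin
    exact i j + (divisible (suc i) j + divisible i (suc j)) ≡⟨ cong (exact i j +_) (∑₂-distrib-+ by₁₀ by₀₁) ⟨
    exact i j + ∑₂ (λ x → by₁₀ x + by₀₁ x)                   ≡⟨ ∑₂-distrib-+ exactly (λ x → by₁₀ x + by₀₁ x) ⟨
    ∑₂ (λ x → exactly x + (by₁₀ x + by₀₁ x))
      ≡⟨ ∑₂-cong (λ x → inclusion-exclusion-at i j (generatorGcd∣n x)) ⟩
    ∑₂ (λ x → by₀₀ x + by₁₁ x)                               ≡⟨ ∑₂-distrib-+ by₀₀ by₁₁ ⟩
    divisible i j + divisible (suc i) (suc j)                ∎
    where
    open ≡-Reasoning
    exactly by₀₀ by₁₀ by₀₁ by₁₁ : Fin n × Fin n → ℕ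
    exactly x = 𝟙 (generatorGcd x ≟ p ^ i * q ^ j)
    by₀₀ x = 𝟙 (p ^ i * q ^ j ∣? generatorGcd x)
    by₁₀ x = 𝟙 (p ^ suc i * q ^ j ∣? generatorGcd x)
    by₀₁ x = 𝟙 (p ^ i * q ^ suc j ∣? generatorGcd x)
    by₁₁ x = 𝟙 (p ^ suc i * q ^ suc j ∣? generatorGcd x)

  divisible-inside : ∀ {i j} → i ≤ 2 → j ≤ 2 → divisible i j ≡ cofactorSquare p i * cofactorSquare q j
  divisible-inside {i} {j} i≤2 j≤2 = begin
    divisible i j                                     ≡⟨ ∑₂-cong 𝟙-∣generatorGcd ⟩
    ∑₂ {n} (λ (a , b) → 𝟙 (d ∣? toℕ a) * 𝟙 (d ∣? toℕ b))
      ≡⟨ ∑₂-* {n} (λ a → 𝟙 (d ∣? toℕ a)) (λ b → 𝟙 (d ∣? toℕ b)) ⟩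
    #multiples * #multiples                           ≡⟨ cong₂ _*_ #multiples≡ #multiples≡ ⟩
    (pᶜ * qᶜ) * (pᶜ * qᶜ)
      ≡⟨ solve 2 (λ x y → (x :* y) :* (x :* y) := (x :* x) :* (y :* y)) refl pᶜ qᶜ ⟩
    (pᶜ * pᶜ) * (qᶜ * qᶜ)                             ≡⟨ cong₂ _*_ (cofactorSquare≡ p i≤2) (cofactorSquare≡ q j≤2) ⟨
    cofactorSquare p i * cofactorSquare q j           ∎
    where
    open ≡-Reasoning
    d pᶜ qᶜ : ℕ
    d  = p ^ i * q ^ j
    pᶜ = p ^ (2 ∸ i)
    qᶜ = q ^ (2 ∸ j)
    instance
      d≢0 : NonZero d
      d≢0 = m*n≢0 (p ^ i) (q ^ j) {{m^n≢0 p i}} {{m^n≢0 q j}}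
    d∣n : d ∣ n
    d∣n = Equivalence.from (p^i*q^j∣p^u*q^v⇔ p-prime q-prime p≢q i j 2 2) (i≤2 , j≤2)
    𝟙-∣generatorGcd : ∀ x → 𝟙 (d ∣? generatorGcd x) ≡ 𝟙 (d ∣? toℕ (proj₁ x)) * 𝟙 (d ∣? toℕ (proj₂ x))
    𝟙-∣generatorGcd (a , b) =
      trans (𝟙-cong (d ∣? generatorGcd (a , b)) (d ∣? toℕ a ×-dec d ∣? toℕ b) (∣generatorGcd⇔ d∣n))
            (𝟙-× (d ∣? toℕ a) (d ∣? toℕ b))
    #multiples : ℕ
    #multiples = count (λ (a : Fin n) → d ∣? toℕ a)
    split-square : ∀ r {k} → k ≤ 2 → r ^ 2 ≡ r ^ (2 ∸ k) * r ^ k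
    split-square r {k} k≤2 = trans (cong (r ^_) (sym (m∸n+n≡m k≤2))) (^-distribˡ-+-* r (2 ∸ k) k)
    n≡cofactor*d : n ≡ (pᶜ * qᶜ) * d
    n≡cofactor*d = trans (cong₂ _*_ (split-square p i≤2) (split-square q j≤2))
      (solve 4 (λ a b c e → (a :* b) :* (c :* e) := (a :* c) :* (b :* e)) refl pᶜ (p ^ i) qᶜ (q ^ j))
    #multiples≡ : #multiples ≡ pᶜ * qᶜ
    #multiples≡ = count-multiples (pᶜ * qᶜ) d n≡cofactor*d

  divisible-beyond : ∀ i j → ¬ (i ≤ 2 × j ≤ 2) → divisible i j ≡ 0
  divisible-beyond i j beyond = count₂-empty (λ x → p ^ i * q ^ j ∣? generatorGcd x)
    (λ x d∣g → beyond (Equivalence.to (p^i*q^j∣p^u*q^v⇔ p-prime q-prime p≢q i j 2 2)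
                                      (∣-trans d∣g (generatorGcd∣n x))))

  divisible≡ : ∀ i j → divisible i j ≡ cofactorSquare p i * cofactorSquare q j
  divisible≡ i j with i ≤? 2 | j ≤? 2
  ... | yes i≤2 | yes j≤2 = divisible-inside i≤2 j≤2
  ... | no  i≰2 | _       = trans (divisible-beyond i j (i≰2 ∘ proj₁))
    (sym (cong (_* cofactorSquare q j) (cofactorSquare-beyond p (≰⇒> i≰2))))
  ... | yes _   | no  j≰2 = trans (divisible-beyond i j (j≰2 ∘ proj₂))
    (sym (trans (cong (cofactorSquare p i *_) (cofactorSquare-beyond q (≰⇒> j≰2))) (*-zeroʳ (cofactorSquare p i))))

  exact≡ : ∀ i j →
    exact i j ≡ (cofactorSquare p i ∸ cofactorSquare p (suc i)) * (cofactorSquare q j ∸ cofactorSquare q (suc j))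
  exact≡ i j = ∸*∸-unique (cofactorSquare-antitone p i) (cofactorSquare-antitone q j) (begin
    exact i j + (P (suc i) * Q j + P i * Q (suc j))
      ≡⟨ cong (exact i j +_) (cong₂ _+_ (divisible≡ (suc i) j) (divisible≡ i (suc j))) ⟨
    exact i j + (divisible (suc i) j + divisible i (suc j))
      ≡⟨ inclusion-exclusion i j ⟩
    divisible i j + divisible (suc i) (suc j)
      ≡⟨ cong₂ _+_ (divisible≡ i j) (divisible≡ (suc i) (suc j)) ⟩
    P i * Q j + P (suc i) * Q (suc j) ∎)
    where
    open ≡-Reasoning
    P Q : ℕ → ℕ
    P = cofactorSquare p
    Q = cofactorSquare q

  p²+q²≤p²q² : p ^ 2 + q ^ 2 ≤ p ^ 2 * q ^ 2
  p²+q²≤p²q² = x+y≤x*y (2≤prime² p-prime) (2≤prime² q-prime)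

  p²+q²≤p²q²-scaled : ∀ c {s t} → s ≡ c * (p ^ 2 + q ^ 2) → c * (p ^ 2 * q ^ 2) ≡ t → s ≤ t
  p²+q²≤p²q²-scaled c s≡ t≡ = subst₂ _≤_ (sym s≡) t≡ (*-monoʳ-≤ c p²+q²≤p²q²)

  p²q²+q⁴≤p²q⁴ : p ^ 2 * q ^ 2 + q ^ 4 ≤ p ^ 2 * q ^ 4
  p²q²+q⁴≤p²q⁴ = p²+q²≤p²q²-scaled (q ^ 2)
    (solve 2 (λ p q → p :^ 2 :* q :^ 2 :+ q :^ 4 := q :^ 2 :* (p :^ 2 :+ q :^ 2)) refl p q)
    (solve 2 (λ p q → q :^ 2 :* (p :^ 2 :* q :^ 2) := p :^ 2 :* q :^ 4) refl p q)

  p²q²+p⁴≤p⁴q² : p ^ 2 * q ^ 2 + p ^ 4 ≤ p ^ 4 * q ^ 2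
  p²q²+p⁴≤p⁴q² = p²+q²≤p²q²-scaled (p ^ 2)
    (solve 2 (λ p q → p :^ 2 :* q :^ 2 :+ p :^ 4 := p :^ 2 :* (p :^ 2 :+ q :^ 2)) refl p q)
    (solve 2 (λ p q → p :^ 2 :* (p :^ 2 :* q :^ 2) := p :^ 4 :* q :^ 2) refl p q)

  p²q⁴+p⁴q²≤p⁴q⁴ : p ^ 2 * q ^ 4 + p ^ 4 * q ^ 2 ≤ p ^ 4 * q ^ 4
  p²q⁴+p⁴q²≤p⁴q⁴ = p²+q²≤p²q²-scaled (p ^ 2 * q ^ 2)
    (solve 2 (λ p q → p :^ 2 :* q :^ 4 :+ p :^ 4 :* q :^ 2 := p :^ 2 :* q :^ 2 :* (p :^ 2 :+ q :^ 2)) refl p q)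
    (solve 2 (λ p q → p :^ 2 :* q :^ 2 :* (p :^ 2 :* q :^ 2) := p :^ 4 :* q :^ 4) refl p q)

  exact-leafCount : ∀ k → exact (proj₁ (exponents k)) (proj₂ (exponents k)) ≡ leafCount p q k
  exact-leafCount 0F = exact≡ 2 2
  exact-leafCount 1F = trans (exact≡ 1 2) (*-identityʳ (p ^ 2 ∸ 1))
  exact-leafCount 2F = trans (exact≡ 0 2) (*-identityʳ (p ^ 4 ∸ p ^ 2))
  exact-leafCount 3F = trans (exact≡ 2 1) (*-identityˡ (q ^ 2 ∸ 1))
  exact-leafCount 4F = trans (exact≡ 2 0) (*-identityˡ (q ^ 4 ∸ q ^ 2))
  exact-leafCount 5F = trans (exact≡ 1 1)
    (∸*∸≡∸∸+ (p ^ 2) 1 (q ^ 2) 1 (p ^ 2) (q ^ 2) (m^n>0 p 2) (m^n>0 q 2)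
      (solve 2 (λ p q → p :^ 2 :+ q :^ 2 := con 1 :* q :^ 2 :+ p :^ 2 :* con 1) refl p q)
      p²+q²≤p²q²)
  exact-leafCount 6F = trans (exact≡ 1 0) (trans
    (∸*∸≡∸∸+ (p ^ 2) 1 (q ^ 4) (q ^ 2) (p ^ 2 * q ^ 2) (q ^ 4) (m^n>0 p 2) (cofactorSquare-antitone q 0)
      (solve 2 (λ p q → p :^ 2 :* q :^ 2 :+ q :^ 4 := con 1 :* q :^ 4 :+ p :^ 2 :* q :^ 2) refl p q)
      p²q²+q⁴≤p²q⁴)
    (cong (p ^ 2 * q ^ 4 ∸ p ^ 2 * q ^ 2 ∸ q ^ 4 +_) (*-identityˡ (q ^ 2))))
  exact-leafCount 7F = trans (exact≡ 0 1) (trans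
    (∸*∸≡∸∸+ (p ^ 4) (p ^ 2) (q ^ 2) 1 (p ^ 2 * q ^ 2) (p ^ 4) (cofactorSquare-antitone p 0) (m^n>0 q 2)
      (solve 2 (λ p q → p :^ 2 :* q :^ 2 :+ p :^ 4 := p :^ 2 :* q :^ 2 :+ p :^ 4 :* con 1) refl p q)
      p²q²+p⁴≤p⁴q²)
    (cong (p ^ 4 * q ^ 2 ∸ p ^ 2 * q ^ 2 ∸ p ^ 4 +_) (*-identityʳ (p ^ 2))))
  exact-leafCount 8F = trans (exact≡ 0 0)
    (∸*∸≡∸∸+ (p ^ 4) (p ^ 2) (q ^ 4) (q ^ 2) (p ^ 2 * q ^ 4) (p ^ 4 * q ^ 2)
      (cofactorSquare-antitone p 0) (cofactorSquare-antitone q 0) refl p²q⁴+p⁴q²≤p⁴q⁴)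

  fibre↔leaves : ∀ k → Σ (Fin n × Fin n) (λ x → generatorClass divisors x ≡ k) ↔ Fin (leafCount p q k)
  fibre↔leaves k = subst (λ c → Σ (Fin n × Fin n) (λ x → generatorClass divisors x ≡ k) ↔ Fin c)
    (exact-leafCount k) (generatorClass-fibre↔ divisors k)

mainTheorem3 : ∀ (p q : ℕ) → Prime p → Prime q → p < q →
    SGB (p ^ 2 * q ^ 2) ≅
      (K₂
      ⊔ K₁, (p ^ 2 ∸ 1)
      ⊔ K₁, (p ^ 4 ∸ p ^ 2)
      ⊔ K₁, (q ^ 2 ∸ 1)
      ⊔ K₁, (q ^ 4 ∸ q ^ 2)
      ⊔ K₁, (p ^ 2 * q ^ 2 ∸ p ^ 2 ∸ q ^ 2 + 1)
      ⊔ K₁, (p ^ 2 * q ^ 4 ∸ p ^ 2 * q ^ 2 ∸ q ^ 4 + q ^ 2)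
      ⊔ K₁, (p ^ 4 * q ^ 2 ∸ p ^ 2 * q ^ 2 ∸ p ^ 4 + p ^ 2)
      ⊔ K₁, (p ^ 4 * q ^ 4 ∸ p ^ 2 * q ^ 4 ∸ p ^ 4 * q ^ 2 + p ^ 2 * q ^ 2))
mainTheorem3 p q p-prime q-prime p<q =
  ≅-trans (SGB≅functionGraph divisors)
  (≅-trans (functionGraph≅starForest (generatorClass divisors) (leafCount p q) fibre↔leaves)
  (≅-trans (starForest≅stars 8 (leafCount p q))
           (⊔-cong K₁,₁≅K₂ ≅-refl)))
  where open ProductOfTwoPrimeSquares p-prime q-prime (<⇒≢ p<q)
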